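{- Let $(f,C)$ be a low-defect pair in the variables $x_1,\ldots,x_r$, and let $p=(k_1,\ldots,k_r)\in(\mathbb{Z}_{\ge0}\cup\{*\})^r$ be such that the set $\{x_i : k_i\ne *\}$ is downward closed in the nesting ordering of $f$. Let $(g,D)$ be the $3$-substitution of $p$ into $(f,C)$. Then: (1) $(g,D)$ is a truncation of $(f,C)$ (and hence a low-defect pair); (2) if $t$ is the number of $i$ with $k_i=*$ and $\iota:\mathbb{Z}_{\ge0}^t\to\mathbb{Z}_{\ge0}^r$ is the map inserting its arguments $(\ell_1,\ldots,\ell_t)$, in order, into the coordinates of $(k_1,\ldots,k_r)$ where $k_i=*$, then $\delta_{g,D}=\delta_{f,C}\circ\iota$. Furthermore, every truncation of $(f,C)$ arises as such a $3$-substitution for some such $p$.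
   Context: $\|n\|$ is the least number of $1$'s needed to write $n\in\mathbb{N}$ using $1$, $+$, $\times$, parentheses. Low-defect expressions: (a) every positive integer constant is one; (b) the product of two low-defect expressions with disjoint variable sets is one; (c) if $E$ is one, $c$ a positive integer and $x$ a variable not in $E$, then $E\cdot x+c$ is one; $\|E\|$ is the sum of complexities of the constants in $E$. $(f,C)$ is a low-defect pair if $f$ is the polynomial obtained from some low-defect expression $E$ with $\|E\|\le C$. Define $\delta_{f,C}(n_1,\ldots,n_r)=C+3(n_1+\cdots+n_r)-3\log_3 f(3^{n_1},\ldots,3^{n_r})$ for $f$ of degree $r$. Nesting ordering: for variables $x,y$ of a low-defect expression $E$, $x\preceq y$ iff $x$ appears in the smallest low-defect subexpression of $E$ containing $y$; this depends only on the polynomial $f$. A set of variables is downward closed if it contains every $x\preceq y$ for each of its elements $y$. Direct truncation: if $x_i$ is minimal in the nesting ordering of $f$ and $k\ge0$ is an integer, the pair $(g,C+3k)$, with $g$ obtained by substituting $3^k$ for $x_i$ in $f$, is a direct truncation of $(f,C)$. A truncation of $(f,C)$ is any pair obtained from it by a finite (possibly empty) sequence of direct truncations. Here $*$ is a symbol distinct from all numbers. The $3$-substitution of $(k_1,\ldots,k_r)$ into $(f,C)$ is $(g,D)$ where $g$ is obtained from $f$ by substituting $3^{k_i}$ for $x_i$ whenever $k_i\ne*$, and $D=C+3\sum_{k_i\ne*}k_i$. -}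

module Defs where

open import Data.Nat using (ℕ; zero; suc; _+_; _*_; _^_; _≤_)
open import Data.Fin using (Fin; zero; suc; cast)
open import Data.Maybe using (Maybe; just; nothing; Is-just)
open import Data.Vec using (Vec; []; _∷_; lookup)
open import Data.Vec.Functional using (insertAt)
open import Data.List using (List; []; _∷_; _++_)
open import Data.List.Membership.Propositional using (_∈_; _∉_)
open import Data.Product using (Σ; ∃; _×_; _,_)
open import Relation.Binary.PropositionalEquality using (_≡_)

data OneExpr : Set where
  one : OneExpr
  _⊕_ : OneExpr → OneExpr → OneExpr
  _⊛_ : OneExpr → OneExpr → OneExpr

val : OneExpr → ℕ
val one = 1
val (a ⊕ b) = val a + val b
val (a ⊛ b) = val a * val b

ones : OneExpr → ℕ
ones one = 1
ones (a ⊕ b) = ones a + ones b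
ones (a ⊛ b) = ones a + ones b

IsCpx : ℕ → ℕ → Set
IsCpx n k = (Σ OneExpr λ e → val e ≡ n × ones e ≡ k)
          × ((e : OneExpr) → val e ≡ n → k ≤ ones e)

-- Polynomials in r variables, represented by their values on ℕ^r
-- (a polynomial with ℕ-coefficients is determined by these values)

Poly : ℕ → Set
Poly r = (Fin r → ℕ) → ℕ

_≗ₚ_ : ∀ {r} → Poly r → Poly r → Set
f ≗ₚ g = ∀ σ → f σ ≡ g σ

data Expr (r : ℕ) : Set where
  con : ℕ → Expr r
  _⊗_ : Expr r → Expr r → Expr r
  lin : Expr r → Fin r → ℕ → Expr r

vars : ∀ {r} → Expr r → List (Fin r)
vars (con n) = []
vars (a ⊗ b) = vars a ++ vars b
vars (lin e x c) = x ∷ vars e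

eval : ∀ {r} → Expr r → Poly r
eval (con n) σ = n
eval (a ⊗ b) σ = eval a σ * eval b σ
eval (lin e x c) σ = eval e σ * σ x + c

data LowDefect {r : ℕ} : Expr r → Set where
  con : ∀ {n} → 1 ≤ n → LowDefect (con n)
  mul : ∀ {a b} → LowDefect a → LowDefect b →
        (∀ x → x ∈ vars a → x ∉ vars b) → LowDefect (a ⊗ b)
  lin : ∀ {e x c} → LowDefect e → x ∉ vars e → 1 ≤ c → LowDefect (lin e x c)

data ECpx {r : ℕ} : Expr r → ℕ → Set where
  con : ∀ {n k} → IsCpx n k → ECpx (con n) k
  mul : ∀ {a b k l} → ECpx a k → ECpx b l → ECpx (a ⊗ b) (k + l)
  lin : ∀ {e x c k l} → ECpx e k → IsCpx c l → ECpx (lin e x c) (k + l)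

Represents : ∀ {r} → Expr r → Poly r → Set
Represents {r} e f = LowDefect e × (∀ (x : Fin r) → x ∈ vars e) × (eval e ≗ₚ f)

LowDefectPair : ∀ {r} → Poly r → ℕ → Set
LowDefectPair {r} f C =
  Σ (Expr r) λ e → Represents e f × Σ ℕ λ k → ECpx e k × k ≤ C

data _⊑_ {r : ℕ} : Expr r → Expr r → Set where
  here : ∀ {a} → a ⊑ a
  inl  : ∀ {a b c} → a ⊑ b → a ⊑ (b ⊗ c)
  inr  : ∀ {a b c} → a ⊑ c → a ⊑ (b ⊗ c)
  inlin : ∀ {a e x c} → a ⊑ e → a ⊑ lin e x c

-- x ⪯ y in E : x occurs in the smallest low-defect subexpression
-- containing y, which is the subterm  lin E' y c  introducing y.
NestE : ∀ {r} → Expr r → Fin r → Fin r → Set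
NestE {r} e x y = Σ (Expr r) λ e' → Σ ℕ λ c → (lin e' y c ⊑ e) × (x ∈ vars (lin e' y c))

Nest : ∀ {r} → Poly r → Fin r → Fin r → Set
Nest {r} f x y = (e : Expr r) → Represents e f → NestE e x y

Minimal : ∀ {r} → Poly r → Fin r → Set
Minimal f x = ∀ y → Nest f y x → y ≡ x

DownClosed : ∀ {r} → Poly r → (Fin r → Set) → Set
DownClosed f S = ∀ x y → S y → Nest f x y → S x

DirectTrunc : ∀ {r} → Poly (suc r) → ℕ → Poly r → ℕ → Set
DirectTrunc {r} f C g D =
  Σ (Fin (suc r)) λ i → Σ ℕ λ k →
    Minimal f i × (∀ σ → g σ ≡ f (insertAt σ i (3 ^ k))) × D ≡ C + 3 * k

data Trunc {r : ℕ} (f : Poly r) (C : ℕ) : {s : ℕ} → Poly s → ℕ → Set where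
  done : ∀ {g D} → g ≗ₚ f → D ≡ C → Trunc f C {r} g D
  step : ∀ {s g D h E} → Trunc f C {suc s} g D → DirectTrunc g D h E →
         Trunc f C {s} h E

-- 3-substitution; entries of p are  just k  (k ∈ ℤ≥0)  or  nothing  (= *)

stars : ∀ {r} → Vec (Maybe ℕ) r → ℕ
stars [] = 0
stars (nothing ∷ p) = suc (stars p)
stars (just k ∷ p) = stars p

sumJust : ∀ {r} → Vec (Maybe ℕ) r → ℕ
sumJust [] = 0
sumJust (nothing ∷ p) = sumJust p
sumJust (just k ∷ p) = k + sumJust p

fill : ∀ {r} {A : Set} (p : Vec (Maybe ℕ) r) → (ℕ → A) → (Fin (stars p) → A) → Fin r → A
fill (nothing ∷ p) h ys zero = ys zero
fill (nothing ∷ p) h ys (suc i) = fill p h (λ j → ys (suc j)) i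
fill (just k ∷ p) h ys zero = h k
fill (just k ∷ p) h ys (suc i) = fill p h ys i

ι : ∀ {r} (p : Vec (Maybe ℕ) r) → (Fin (stars p) → ℕ) → Fin r → ℕ
ι p = fill p (λ k → k)

subPoly : ∀ {r} (p : Vec (Maybe ℕ) r) → Poly r → Poly (stars p)
subPoly p f ys = f (fill p (λ k → 3 ^ k) ys)

subConst : ∀ {r} → Vec (Maybe ℕ) r → ℕ → ℕ
subConst p C = C + 3 * sumJust p

-- Defect δ_{f,C}(n) = C + 3Σn − 3 log₃ f(3^n).  No reals: a value
-- a − 3 log₃ v (v > 0) is represented by the pair (a , v), and
-- (a , v) ≈ (b , w)  iff  a − 3log₃ v = b − 3log₃ w  iff  3^a·w³ = 3^b·v³.

sumF : ∀ {r} → (Fin r → ℕ) → ℕ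
sumF {zero} n = 0
sumF {suc r} n = n zero + sumF (λ i → n (suc i))

δ : ∀ {r} → Poly r → ℕ → (Fin r → ℕ) → ℕ × ℕ
δ f C n = (C + 3 * sumF n , f (λ i → 3 ^ n i))

_≈δ_ : ℕ × ℕ → ℕ × ℕ → Set
(a , v) ≈δ (b , w) = 3 ^ a * (w * w * w) ≡ 3 ^ b * (v * v * v)

-- Nesting is a property of f, not of the expression: for x ≢ y, x lies below y in a
-- low-defect expression for f iff f ignores x on the hyperplane y = 0, because x then sits in
-- the factor multiplied by y, while otherwise raising x strictly increases f at a point that
-- is positive off y. So downward closure and minimality may be read off any expression.
-- A variable is minimal iff its node has a closed body b; substituting 3^k for it turns the
-- node b·x + c into the constant b·3^k + c, of complexity at most ‖b‖ + ‖c‖ + 3k, so a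
-- direct truncation is again a low-defect pair. Given a downward closed pattern, the node
-- of an innermost fixed variable has a closed body, so the fixed variables can be truncated
-- one at a time; both C and the exponent sum gain 3Σk, so δ is unchanged. Conversely, along
-- a truncation the newly fixed variable is minimal after substitution, so every variable
-- below it was fixed before, and the fixed set stays downward closed.

module Submission where

open import Defs
open import Data.Empty using (⊥; ⊥-elim)
open import Data.Fin using (Fin; zero; suc; cast; punchIn; punchOut)
open import Data.Fin.Properties using (punchIn-punchOut; punchIn-injective; punchInᵢ≢i)
  renaming (_≟_ to _≟ᶠ_)
open import Data.List using (List; []; _∷_; _++_; cartesianProductWith)
open import Data.List.Membership.Propositional using (_∈_; _∉_; lose)
open import Data.List.Membership.Propositional.Properties
  using (∈-++⁺ˡ; ∈-++⁺ʳ; ∈-++⁻; ∈-cartesianProductWith⁺)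
open import Data.List.Relation.Unary.Any using (here; there; any?; satisfied)
open import Data.Maybe using (Maybe; just; nothing; Is-just)
open import Data.Maybe.Relation.Unary.Any using (just)
open import Data.Nat using (ℕ; zero; suc; pred; _+_; _*_; _^_; _≤_; _<_; _≟_; >-nonZero; anyUpTo?)
open import Data.Nat.Induction using (<-rec)
open import Data.Nat.Properties
open import Algebra.Properties.CommutativeSemigroup +-commutativeSemigroup using (x∙yz≈y∙xz; xy∙z≈xz∙y)
open import Data.Nat.Tactic.RingSolver using (solve-∀)
open import Data.Product using (Σ; _×_; _,_; proj₁; proj₂)
open import Data.Sum using (_⊎_; inj₁; inj₂; [_,_]′)
open import Data.Unit using (tt)
open import Data.Vec using (Vec; []; _∷_; lookup)
open import Data.Vec.Functional using (insertAt)
open import Data.Vec.Functional.Properties using (insertAt-punchIn; insertAt-lookup)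
open import Function using (_∘_)
open import Relation.Nullary using (Dec; yes; no; ¬_; contradiction)
open import Relation.Nullary.Decidable using (map′; _×-dec_)
open import Relation.Binary.PropositionalEquality

private
  variable
    r s : ℕ
    A : Set

-- Subexpressions

⊑-trans : {a b c : Expr r} → a ⊑ b → b ⊑ c → a ⊑ c
⊑-trans p here      = p
⊑-trans p (inl q)   = inl (⊑-trans p q)
⊑-trans p (inr q)   = inr (⊑-trans p q)
⊑-trans p (inlin q) = inlin (⊑-trans p q)

∈-vars-⊑ : {t e : Expr r} {x : Fin r} → t ⊑ e → x ∈ vars t → x ∈ vars e
∈-vars-⊑ here        m = m
∈-vars-⊑ (inl q)     m = ∈-++⁺ˡ (∈-vars-⊑ q m)
∈-vars-⊑ {e = b ⊗ _} (inr q) m = ∈-++⁺ʳ (vars b) (∈-vars-⊑ q m)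
∈-vars-⊑ (inlin q)   m = there (∈-vars-⊑ q m)

LowDefect-⊑ : {t e : Expr r} → t ⊑ e → LowDefect e → LowDefect t
LowDefect-⊑ here      l               = l
LowDefect-⊑ (inl q)   (mul la _ _)    = LowDefect-⊑ q la
LowDefect-⊑ (inr q)   (mul _ lb _)    = LowDefect-⊑ q lb
LowDefect-⊑ (inlin q) (lin le _ _)    = LowDefect-⊑ q le

eval-cong : (e : Expr r) {σ τ : Fin r → ℕ} →
            (∀ z → z ∈ vars e → σ z ≡ τ z) → eval e σ ≡ eval e τ
eval-cong (con n)     h = refl
eval-cong (a ⊗ b)     h = cong₂ _*_ (eval-cong a (λ z m → h z (∈-++⁺ˡ m)))
                                    (eval-cong b (λ z m → h z (∈-++⁺ʳ (vars a) m)))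
eval-cong (lin e x c) h =
  cong (_+ c) (cong₂ _*_ (eval-cong e (λ z m → h z (there m))) (h x (here refl)))

eval-pos : {e : Expr r} (σ : Fin r → ℕ) → LowDefect e → 1 ≤ eval e σ
eval-pos σ (con 1≤n)           = 1≤n
eval-pos σ (mul la lb _)       = *-mono-≤ (eval-pos σ la) (eval-pos σ lb)
eval-pos σ (lin {e = e} _ _ 1≤c) = ≤-trans 1≤c (m≤n+m _ (eval e σ * σ _))

eval-mono : (e : Expr r) {σ τ : Fin r → ℕ} → (∀ z → σ z ≤ τ z) → eval e σ ≤ eval e τ
eval-mono (con n)     h = ≤-refl
eval-mono (a ⊗ b)     h = *-mono-≤ (eval-mono a h) (eval-mono b h)
eval-mono (lin e x c) h = +-monoˡ-≤ c (*-mono-≤ (eval-mono e h) (h x))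

nodeOf : (e : Expr r) {x : Fin r} → x ∈ vars e → Σ (Expr r) λ e′ → Σ ℕ λ c → lin e′ x c ⊑ e
nodeOf (a ⊗ b) m with ∈-++⁻ (vars a) m
... | inj₁ ma = let (e′ , c , q) = nodeOf a ma in e′ , c , inl q
... | inj₂ mb = let (e′ , c , q) = nodeOf b mb in e′ , c , inr q
nodeOf (lin e x c) (here refl) = e , c , here
nodeOf (lin e x c) (there m)   = let (e′ , c′ , q) = nodeOf e m in e′ , c′ , inlin q

NestE-⊑ : {t e : Expr r} {x y : Fin r} → t ⊑ e → NestE t x y → NestE e x y
NestE-⊑ t⊑e (e′ , c , q , m) = e′ , c , ⊑-trans q t⊑e , m

node-unique : {e a b : Expr r} {x : Fin r} {c d : ℕ} → LowDefect e →
              lin a x c ⊑ e → lin b x d ⊑ e → a ≡ b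
node-unique l               here      here       = refl
node-unique (lin _ x∉ _)    here      (inlin q)  = ⊥-elim (x∉ (∈-vars-⊑ q (here refl)))
node-unique (lin _ x∉ _)    (inlin q) here       = ⊥-elim (x∉ (∈-vars-⊑ q (here refl)))
node-unique (lin le _ _)    (inlin q) (inlin q′) = node-unique le q q′
node-unique (mul la _ _)    (inl q)   (inl q′)   = node-unique la q q′
node-unique (mul _ lb _)    (inr q)   (inr q′)   = node-unique lb q q′
node-unique (mul _ _ disj)  (inl q)   (inr q′)   =
  ⊥-elim (disj _ (∈-vars-⊑ q (here refl)) (∈-vars-⊑ q′ (here refl)))
node-unique (mul _ _ disj)  (inr q)   (inl q′)   =
  ⊥-elim (disj _ (∈-vars-⊑ q′ (here refl)) (∈-vars-⊑ q (here refl)))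

-- The nesting ordering

Indep : Poly r → Fin r → Fin r → Set
Indep f x y = ∀ σ τ → σ y ≡ 0 → (∀ z → z ≢ x → σ z ≡ τ z) → f σ ≡ f τ

Indep-resp : {f g : Poly r} {x y : Fin r} → f ≗ₚ g → Indep f x y → Indep g x y
Indep-resp f≗g ind σ τ σy≡0 agree = trans (sym (f≗g σ)) (trans (ind σ τ σy≡0 agree) (f≗g τ))

eval-cong-off : (b : Expr r) {x : Fin r} {σ τ : Fin r → ℕ} → x ∉ vars b →
                (∀ z → z ≢ x → σ z ≡ τ z) → eval b σ ≡ eval b τ
eval-cong-off b x∉ agree = eval-cong b λ z m → agree z λ { refl → x∉ m }

node-indep : {t e′ : Expr r} {x y : Fin r} {c : ℕ} {σ τ : Fin r → ℕ} →
             lin e′ y c ⊑ t → LowDefect t → x ∈ vars e′ → σ y ≡ 0 → τ y ≡ 0 →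
             (∀ z → z ≢ x → σ z ≡ τ z) → eval t σ ≡ eval t τ
node-indep {e′ = e′} {c = c} {σ} {τ} here l m σy≡0 τy≡0 agree rewrite σy≡0 | τy≡0 =
  cong (_+ c) (trans (*-zeroʳ (eval e′ σ)) (sym (*-zeroʳ (eval e′ τ))))
node-indep {t = a ⊗ b} (inl q) (mul la lb disj) m σy τy agree =
  cong₂ _*_ (node-indep q la m σy τy agree) (eval-cong-off b (disj _ (∈-vars-⊑ q (there m))) agree)
node-indep {t = a ⊗ b} (inr q) (mul la lb disj) m σy τy agree =
  cong₂ _*_ (eval-cong-off a (λ ma → disj _ ma (∈-vars-⊑ q (there m))) agree)
            (node-indep q lb m σy τy agree)
node-indep {t = lin e z c} (inlin q) (lin le z∉ _) m σy τy agree =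
  cong (_+ c) (cong₂ _*_ (node-indep q le m σy τy agree)
                         (agree z λ { refl → z∉ (∈-vars-⊑ q (there m)) }))

NestE⇒Indep : {e : Expr r} {x y : Fin r} → LowDefect e → x ≢ y → NestE e x y → Indep (eval e) x y
NestE⇒Indep l x≢y (_ , _ , q , here refl) = ⊥-elim (x≢y refl)
NestE⇒Indep l x≢y (_ , _ , q , there m) σ τ σy≡0 agree =
  node-indep q l m σy≡0 (trans (sym (agree _ (λ y≡x → x≢y (sym y≡x)))) σy≡0) agree

Raise : Fin r → (Fin r → ℕ) → (Fin r → ℕ) → Set
Raise x σ τ = σ x < τ x × (∀ z → z ≢ x → σ z ≡ τ z)

Raise⇒≤ : {x : Fin r} {σ τ : Fin r → ℕ} → Raise x σ τ → ∀ z → σ z ≤ τ z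
Raise⇒≤ {x = x} (lt , agree) z with z ≟ᶠ x
... | yes refl = <⇒≤ lt
... | no z≢x   = ≤-reflexive (agree z z≢x)

*-<-≤ : ∀ {a a′ b b′} → a < a′ → b ≤ b′ → 1 ≤ b → a * b < a′ * b′
*-<-≤ {a} {a′} {b} {b′} a<a′ b≤b′ 1≤b = begin-strict
  a * b   <⟨ *-monoˡ-< b {{>-nonZero 1≤b}} a<a′ ⟩
  a′ * b  ≤⟨ *-monoʳ-≤ a′ b≤b′ ⟩
  a′ * b′ ∎
  where open ≤-Reasoning

*-≤-< : ∀ {a a′ b b′} → a ≤ a′ → b < b′ → 1 ≤ a → a * b < a′ * b′
*-≤-< {a} {a′} {b} {b′} a≤a′ b<b′ 1≤a =
  subst₂ _<_ (*-comm b a) (*-comm b′ a′) (*-<-≤ b<b′ a≤a′ 1≤a)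

NestE-or-increasing : (e : Expr r) {x y : Fin r} {σ τ : Fin r → ℕ} →
  LowDefect e → x ∈ vars e → x ≢ y → (∀ z → z ≢ y → 1 ≤ σ z) → Raise x σ τ →
  NestE e x y ⊎ eval e σ < eval e τ
NestE-or-increasing (a ⊗ b) {σ = σ} {τ} (mul la lb _) m x≢y pos raise with ∈-++⁻ (vars a) m
... | inj₁ ma with NestE-or-increasing a la ma x≢y pos raise
...   | inj₁ (e′ , c , q , m′) = inj₁ (e′ , c , inl q , m′)
...   | inj₂ lt = inj₂ (*-<-≤ lt (eval-mono b (Raise⇒≤ raise)) (eval-pos σ lb))
NestE-or-increasing (a ⊗ b) {σ = σ} {τ} (mul la lb _) m x≢y pos raise | inj₂ mb
      with NestE-or-increasing b lb mb x≢y pos raise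
...   | inj₁ (e′ , c , q , m′) = inj₁ (e′ , c , inr q , m′)
...   | inj₂ lt = inj₂ (*-≤-< (eval-mono a (Raise⇒≤ raise)) lt (eval-pos σ la))
NestE-or-increasing (lin e z c) {σ = σ} (lin le _ _) (here refl) x≢y pos raise@(lt , _) =
  inj₂ (+-monoˡ-< c (*-≤-< (eval-mono e (Raise⇒≤ raise)) lt (eval-pos σ le)))
NestE-or-increasing (lin e z c) {y = y} (lin le z∉ _) (there m) x≢y pos raise@(_ , agree)
  with z ≟ᶠ y
... | yes refl = inj₁ (e , c , here , there m)
... | no z≢y with NestE-or-increasing e le m x≢y pos raise
...   | inj₁ (e′ , c′ , q , m′) = inj₁ (e′ , c′ , inlin q , m′)
...   | inj₂ lt = inj₂ (+-monoˡ-< c (*-<-≤ lt (≤-reflexive (agree z λ { refl → z∉ m })) (pos z z≢y)))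

probe : Fin r → Fin r → ℕ
probe y z with z ≟ᶠ y
... | yes _ = 0
... | no _  = 1

probe-zero : (y : Fin r) → probe y y ≡ 0
probe-zero y with y ≟ᶠ y
... | yes _  = refl
... | no y≢y = ⊥-elim (y≢y refl)

probe-pos : (y z : Fin r) → z ≢ y → 1 ≤ probe y z
probe-pos y z z≢y with z ≟ᶠ y
... | yes z≡y = ⊥-elim (z≢y z≡y)
... | no _    = ≤-refl

raise : Fin r → (Fin r → ℕ) → Fin r → ℕ
raise x σ z with z ≟ᶠ x
... | yes _ = suc (σ z)
... | no _  = σ z

Raise-raise : (x : Fin r) (σ : Fin r → ℕ) → Raise x σ (raise x σ)
Raise-raise x σ = at-x , off-x
  where
  at-x : σ x < raise x σ x
  at-x with x ≟ᶠ x
  ... | yes _  = ≤-refl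
  ... | no x≢x = ⊥-elim (x≢x refl)
  off-x : ∀ z → z ≢ x → σ z ≡ raise x σ z
  off-x z z≢x with z ≟ᶠ x
  ... | yes z≡x = ⊥-elim (z≢x z≡x)
  ... | no _    = refl

Indep⇒NestE : {e : Expr r} {x y : Fin r} → LowDefect e → x ∈ vars e → x ≢ y →
              Indep (eval e) x y → NestE e x y
Indep⇒NestE {e = e} {x} {y} l m x≢y ind
  with NestE-or-increasing e l m x≢y (probe-pos y) (Raise-raise x (probe y))
... | inj₁ nest = nest
... | inj₂ lt   =
  ⊥-elim (<-irrefl (ind (probe y) _ (probe-zero y) (proj₂ (Raise-raise x (probe y)))) lt)

Nest-refl : {f : Poly r} (y : Fin r) → Nest f y y
Nest-refl y e (_ , all∈ , _) = let (e′ , c , q) = nodeOf e (all∈ y) in e′ , c , q , here refl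

Indep⇒Nest : {f : Poly r} {x y : Fin r} → x ≢ y → Indep f x y → Nest f x y
Indep⇒Nest x≢y ind e (l , all∈ , e≗f) =
  Indep⇒NestE l (all∈ _) x≢y (Indep-resp (λ σ → sym (e≗f σ)) ind)

Nest⇒Indep : {f : Poly r} {e : Expr r} {x y : Fin r} →
             Represents e f → x ≢ y → Nest f x y → Indep f x y
Nest⇒Indep {e = e} rep@(l , _ , e≗f) x≢y nest = Indep-resp e≗f (NestE⇒Indep l x≢y (nest e rep))

NestE⇒Nest : {f : Poly r} {e : Expr r} {x y : Fin r} → Represents e f → NestE e x y → Nest f x y
NestE⇒Nest {x = x} {y} (l , _ , e≗f) nest with x ≟ᶠ y
... | yes refl = Nest-refl y
... | no x≢y   = Indep⇒Nest x≢y (Indep-resp e≗f (NestE⇒Indep l x≢y nest))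

-- Integer complexity

Writable : ℕ → ℕ → Set
Writable n k = Σ OneExpr λ e → val e ≡ n × ones e ≡ k

Writable-+ : ∀ {a b k l} → Writable a k → Writable b l → Writable (a + b) (k + l)
Writable-+ (A , refl , refl) (B , refl , refl) = A ⊕ B , refl , refl

Writable-* : ∀ {a b k l} → Writable a k → Writable b l → Writable (a * b) (k + l)
Writable-* (A , refl , refl) (B , refl , refl) = A ⊛ B , refl , refl

Writable-*3^ : ∀ {a k} → Writable a k → ∀ m → Writable (a * 3 ^ m) (k + 3 * m)
Writable-*3^ {a} {k} w zero = subst₂ Writable (sym (*-identityʳ a)) (sym (+-identityʳ k)) w
Writable-*3^ {a} {k} w (suc m) =
  subst₂ Writable (shift a (3 ^ m)) (shift′ k m) (Writable-* (Writable-*3^ w m) three)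
  where
  three : Writable 3 3
  three = one ⊕ (one ⊕ one) , refl , refl
  shift : ∀ a b → a * b * 3 ≡ a * (3 * b)
  shift = solve-∀
  shift′ : ∀ k m → k + 3 * m + 3 ≡ k + 3 * suc m
  shift′ = solve-∀

ones-pos : ∀ e → 1 ≤ ones e
ones-pos one     = ≤-refl
ones-pos (a ⊕ b) = ≤-trans (ones-pos a) (m≤m+n (ones a) (ones b))
ones-pos (a ⊛ b) = ≤-trans (ones-pos a) (m≤m+n (ones a) (ones b))

oneExprs : ℕ → List OneExpr
oneExprs zero    = []
oneExprs (suc d) = one ∷ cartesianProductWith _⊕_ es es ++ cartesianProductWith _⊛_ es es
  where es = oneExprs d

summands-≤ : ∀ {a b d} → 1 ≤ a → 1 ≤ b → a + b ≤ suc d → a ≤ d × b ≤ d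
summands-≤ {a} {b} 1≤a 1≤b a+b≤1+d =
  ≤-pred (≤-trans (subst (_≤ a + b) (+-comm a 1) (+-monoʳ-≤ a 1≤b)) a+b≤1+d) ,
  ≤-pred (≤-trans (+-monoˡ-≤ b 1≤a) a+b≤1+d)

∈-oneExprs : ∀ e {d} → ones e ≤ d → e ∈ oneExprs d
∈-oneExprs e {zero} ones≤0 = contradiction (≤-trans (ones-pos e) ones≤0) λ ()
∈-oneExprs one     {suc d} _  = here refl
∈-oneExprs (a ⊕ b) {suc d} le =
  let (a≤d , b≤d) = summands-≤ (ones-pos a) (ones-pos b) le in
  there (∈-++⁺ˡ (∈-cartesianProductWith⁺ _⊕_ (∈-oneExprs a a≤d) (∈-oneExprs b b≤d)))
∈-oneExprs (a ⊛ b) {suc d} le =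
  let (a≤d , b≤d) = summands-≤ (ones-pos a) (ones-pos b) le in
  there (∈-++⁺ʳ (cartesianProductWith _⊕_ (oneExprs d) (oneExprs d))
                (∈-cartesianProductWith⁺ _⊛_ (∈-oneExprs a a≤d) (∈-oneExprs b b≤d)))

writable? : ∀ n k → Dec (Writable n k)
writable? n k = map′ satisfied (λ (e , w@(_ , ones≡k)) → lose (∈-oneExprs e (≤-reflexive ones≡k)) w)
                     (any? (λ e → (val e ≟ n) ×-dec (ones e ≟ k)) (oneExprs k))

Least : (ℕ → Set) → ℕ → Set
Least P k = P k × (∀ {j} → j < k → ¬ P j)

least : {P : ℕ → Set} → (∀ n → Dec (P n)) → ∀ {n} → P n → Σ ℕ (Least P)
least {P} P? {n} = <-rec (λ n → P n → Σ ℕ (Least P)) search n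
  where
  search : ∀ n → (∀ {m} → m < n → P m → Σ ℕ (Least P)) → P n → Σ ℕ (Least P)
  search n rec pn with anyUpTo? P? n
  ... | yes (m , m<n , pm) = rec m<n pm
  ... | no none            = n , pn , λ j<n pj → none (_ , j<n , pj)

complexity : ∀ {n k} → Writable n k → Σ ℕ λ c → IsCpx n c × c ≤ k
complexity {n} w with least (writable? n) w
... | c , wc , below =
  c , (wc , λ e val≡n → ≮⇒≥ λ lt → below lt (e , val≡n , refl)) , ≮⇒≥ λ lt → below lt w

-- Instantiating a minimal variable

Closed : Expr r → Set
Closed e = ∀ y → y ∉ vars e

ClosedAt : Fin r → Expr r → Set
ClosedAt i e = ∀ e′ c → lin e′ i c ⊑ e → Closed e′

ClosedAt-⊑ : {i : Fin r} {t e : Expr r} → t ⊑ e → ClosedAt i e → ClosedAt i t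
ClosedAt-⊑ t⊑e closed e′ c q = closed e′ c (⊑-trans q t⊑e)

closed-Writable : {e : Expr r} {K : ℕ} (σ : Fin r → ℕ) → ECpx e K → Closed e → Writable (eval e σ) K
closed-Writable σ (con (w , _)) _ = w
closed-Writable {e = a ⊗ b} σ (mul ca cb) closed =
  Writable-* (closed-Writable σ ca λ y m → closed y (∈-++⁺ˡ m))
             (closed-Writable σ cb λ y m → closed y (∈-++⁺ʳ (vars a) m))
closed-Writable σ (lin {x = x} _ _) closed = ⊥-elim (closed x (here refl))

-- Used only when the node of i has a closed body, whose value is then its value at 0.
instantiate : Fin (suc r) → ℕ → Expr (suc r) → Expr r
instantiate i v (con n)     = con n
instantiate i v (a ⊗ b)     = instantiate i v a ⊗ instantiate i v b
instantiate i v (lin e z c) with i ≟ᶠ z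
... | yes _   = con (eval e (λ _ → 0) * v + c)
... | no i≢z  = lin (instantiate i v e) (punchOut i≢z) c

eval-instantiate : (i : Fin (suc r)) (v : ℕ) (e : Expr (suc r)) → ClosedAt i e →
                   ∀ σ → eval (instantiate i v e) σ ≡ eval e (insertAt σ i v)
eval-instantiate i v (con n) _ σ = refl
eval-instantiate i v (a ⊗ b) closed σ =
  cong₂ _*_ (eval-instantiate i v a (ClosedAt-⊑ (inl here) closed) σ)
            (eval-instantiate i v b (ClosedAt-⊑ (inr here) closed) σ)
eval-instantiate i v (lin e z c) closed σ with i ≟ᶠ z
... | yes refl = cong (_+ c) (cong₂ _*_ (eval-cong e λ y m → ⊥-elim (closed e c here y m))
                                        (sym (insertAt-lookup σ i v)))
... | no i≢z   = cong (_+ c) (cong₂ _*_ (eval-instantiate i v e (ClosedAt-⊑ (inlin here) closed) σ)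
                   (trans (sym (insertAt-punchIn σ i v (punchOut i≢z)))
                          (cong (insertAt σ i v) (punchIn-punchOut i≢z))))

∈-vars-instantiate⁻ : (i : Fin (suc r)) (v : ℕ) (e : Expr (suc r)) {x : Fin r} →
                      x ∈ vars (instantiate i v e) → punchIn i x ∈ vars e
∈-vars-instantiate⁻ i v (a ⊗ b) m with ∈-++⁻ (vars (instantiate i v a)) m
... | inj₁ ma = ∈-++⁺ˡ (∈-vars-instantiate⁻ i v a ma)
... | inj₂ mb = ∈-++⁺ʳ (vars a) (∈-vars-instantiate⁻ i v b mb)
∈-vars-instantiate⁻ i v (lin e z c) m with i ≟ᶠ z
∈-vars-instantiate⁻ i v (lin e z c) (here refl) | no i≢z = here (punchIn-punchOut i≢z)
∈-vars-instantiate⁻ i v (lin e z c) (there m)   | no i≢z = there (∈-vars-instantiate⁻ i v e m)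

∈-vars-instantiate⁺ : (i : Fin (suc r)) (v : ℕ) (e : Expr (suc r)) → ClosedAt i e →
                      ∀ x → punchIn i x ∈ vars e → x ∈ vars (instantiate i v e)
∈-vars-instantiate⁺ i v (a ⊗ b) closed x m with ∈-++⁻ (vars a) m
... | inj₁ ma = ∈-++⁺ˡ (∈-vars-instantiate⁺ i v a (ClosedAt-⊑ (inl here) closed) x ma)
... | inj₂ mb = ∈-++⁺ʳ (vars (instantiate i v a))
                      (∈-vars-instantiate⁺ i v b (ClosedAt-⊑ (inr here) closed) x mb)
∈-vars-instantiate⁺ i v (lin e z c) closed x m with i ≟ᶠ z
∈-vars-instantiate⁺ i v (lin e z c) closed x (here eq) | yes refl = ⊥-elim (punchInᵢ≢i i x eq)
∈-vars-instantiate⁺ i v (lin e z c) closed x (there m) | yes refl = ⊥-elim (closed e c here _ m)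
∈-vars-instantiate⁺ i v (lin e z c) closed x (here eq) | no i≢z =
  here (punchIn-injective i x (punchOut i≢z) (trans eq (sym (punchIn-punchOut i≢z))))
∈-vars-instantiate⁺ i v (lin e z c) closed x (there m) | no i≢z =
  there (∈-vars-instantiate⁺ i v e (ClosedAt-⊑ (inlin here) closed) x m)

LowDefect-instantiate : (i : Fin (suc r)) (v : ℕ) {e : Expr (suc r)} → LowDefect e →
                        LowDefect (instantiate i v e)
LowDefect-instantiate i v (con 1≤n) = con 1≤n
LowDefect-instantiate i v {a ⊗ b} (mul la lb disj) =
  mul (LowDefect-instantiate i v la) (LowDefect-instantiate i v lb)
      λ x ma mb → disj _ (∈-vars-instantiate⁻ i v a ma) (∈-vars-instantiate⁻ i v b mb)
LowDefect-instantiate i v {lin e z c} (lin le z∉ 1≤c) with i ≟ᶠ z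
... | yes _  = con (≤-trans 1≤c (m≤n+m c _))
... | no i≢z = lin (LowDefect-instantiate i v le)
                   (λ m → z∉ (subst (_∈ vars e) (punchIn-punchOut i≢z) (∈-vars-instantiate⁻ i v e m)))
                   1≤c

NestE-instantiate : (i : Fin (suc r)) (v : ℕ) (e : Expr (suc r)) {x y : Fin r} →
                    NestE (instantiate i v e) x y → NestE e (punchIn i x) (punchIn i y)
NestE-instantiate i v (con n) (_ , _ , () , _)
NestE-instantiate i v (a ⊗ b) (e′ , c , inl q , m) =
  NestE-⊑ (inl here) (NestE-instantiate i v a (e′ , c , q , m))
NestE-instantiate i v (a ⊗ b) (e′ , c , inr q , m) =
  NestE-⊑ (inr here) (NestE-instantiate i v b (e′ , c , q , m))
NestE-instantiate i v (lin e z c) nest with i ≟ᶠ z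
NestE-instantiate i v (lin e z c) (_ , _ , () , _) | yes _
NestE-instantiate i v (lin e z c) {x} (_ , _ , here , m) | no i≢z =
  subst (NestE (lin e z c) (punchIn i x)) (sym (punchIn-punchOut i≢z)) (e , c , here , m′ m)
  where
  m′ : x ∈ vars (lin (instantiate i v e) (punchOut i≢z) c) → punchIn i x ∈ vars (lin e z c)
  m′ (here refl) = here (punchIn-punchOut i≢z)
  m′ (there mx)  = there (∈-vars-instantiate⁻ i v e mx)
NestE-instantiate i v (lin e z c) (e′ , c′ , inlin q , m) | no i≢z =
  NestE-⊑ (inlin here) (NestE-instantiate i v e (e′ , c′ , q , m))

ECpx-instantiate-∉ : (i : Fin (suc r)) (v : ℕ) (e : Expr (suc r)) {K : ℕ} →
                     i ∉ vars e → ECpx e K → ECpx (instantiate i v e) K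
ECpx-instantiate-∉ i v (con n) _ (con cpx) = con cpx
ECpx-instantiate-∉ i v (a ⊗ b) i∉ (mul ca cb) =
  mul (ECpx-instantiate-∉ i v a (λ m → i∉ (∈-++⁺ˡ m)) ca)
      (ECpx-instantiate-∉ i v b (λ m → i∉ (∈-++⁺ʳ (vars a) m)) cb)
ECpx-instantiate-∉ i v (lin e z c) i∉ (lin ce cc) with i ≟ᶠ z
... | yes refl = ⊥-elim (i∉ (here refl))
... | no _     = lin (ECpx-instantiate-∉ i v e (λ m → i∉ (there m)) ce) cc

-- ‖b·3^k + c‖ ≤ ‖b‖ + 3k + ‖c‖ is the only source of the extra cost 3k.
ECpx-instantiate : (i : Fin (suc r)) (k : ℕ) (e : Expr (suc r)) {K : ℕ} →
                   LowDefect e → ClosedAt i e → ECpx e K →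
                   Σ ℕ λ K′ → ECpx (instantiate i (3 ^ k) e) K′ × K′ ≤ K + 3 * k
ECpx-instantiate i k (con n) _ _ (con cpx) = _ , con cpx , m≤m+n _ _
ECpx-instantiate i k (a ⊗ b) (mul la lb disj) closed (mul {k = Ka} {l = Kb} ca cb)
  with any? (i ≟ᶠ_) (vars a)
... | yes i∈a =
  let (Ka′ , ca′ , Ka′≤) = ECpx-instantiate i k a la (ClosedAt-⊑ (inl here) closed) ca in
  Ka′ + Kb , mul ca′ (ECpx-instantiate-∉ i (3 ^ k) b (disj i i∈a) cb) ,
  ≤-trans (+-monoˡ-≤ Kb Ka′≤) (≤-reflexive (xy∙z≈xz∙y Ka (3 * k) Kb))
... | no i∉a =
  let (Kb′ , cb′ , Kb′≤) = ECpx-instantiate i k b lb (ClosedAt-⊑ (inr here) closed) cb in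
  Ka + Kb′ , mul (ECpx-instantiate-∉ i (3 ^ k) a i∉a ca) cb′ ,
  ≤-trans (+-monoʳ-≤ Ka Kb′≤) (≤-reflexive (sym (+-assoc Ka Kb (3 * k))))
ECpx-instantiate i k (lin e z c) (lin le _ _) closed (lin {k = Ke} {l = Kc} ce cc) with i ≟ᶠ z
... | no _ =
  let (Ke′ , ce′ , Ke′≤) = ECpx-instantiate i k e le (ClosedAt-⊑ (inlin here) closed) ce in
  Ke′ + Kc , lin ce′ cc , ≤-trans (+-monoˡ-≤ Kc Ke′≤) (≤-reflexive (xy∙z≈xz∙y Ke (3 * k) Kc))
... | yes refl =
  let written = Writable-+ (Writable-*3^ (closed-Writable (λ _ → 0) ce (closed e c here)) k)
                           (proj₁ cc)
      (K′ , cpx , K′≤) = complexity written in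
  K′ , con cpx , ≤-trans K′≤ (≤-reflexive (xy∙z≈xz∙y Ke (3 * k) Kc))

Minimal⇒ClosedAt : {f : Poly r} {e : Expr r} {i : Fin r} → Represents e f → Minimal f i → ClosedAt i e
Minimal⇒ClosedAt rep@(l , _) minimal e′ c q y m with LowDefect-⊑ q l
... | lin _ i∉ _ = i∉ (subst (_∈ vars e′) (minimal y (NestE⇒Nest rep (e′ , c , q , there m))) m)

closedNode⇒Minimal : {f : Poly r} {e e₀ : Expr r} {i : Fin r} {c : ℕ} →
                     Represents e f → lin e₀ i c ⊑ e → Closed e₀ → Minimal f i
closedNode⇒Minimal {e = e} rep@(l , _) q closed y nest with nest e rep
... | _ , _ , q′ , here y≡i = y≡i
... | _ , _ , q′ , there m  = ⊥-elim (closed y (subst (λ t → y ∈ vars t) (node-unique l q′ q) m))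

instantiate-Represents : {f : Poly (suc r)} {e : Expr (suc r)} (i : Fin (suc r)) (v : ℕ) →
                         Represents e f → ClosedAt i e →
                         Represents (instantiate i v e) (λ σ → f (insertAt σ i v))
instantiate-Represents {e = e} i v (l , all∈ , e≗f) closed =
  LowDefect-instantiate i v l ,
  (λ x → ∈-vars-instantiate⁺ i v e closed x (all∈ _)) ,
  λ σ → trans (eval-instantiate i v e closed σ) (e≗f _)

Represents-resp : {e : Expr r} {f g : Poly r} → Represents e f → f ≗ₚ g → Represents e g
Represents-resp (l , all∈ , e≗f) f≗g = l , all∈ , λ σ → trans (e≗f σ) (f≗g σ)

DirectTrunc⇒LowDefectPair : {f : Poly (suc r)} {g : Poly r} {C D : ℕ} →
                            LowDefectPair f C → DirectTrunc f C g D → LowDefectPair g D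
DirectTrunc⇒LowDefectPair (e , rep@(l , _) , K , cost , K≤C) (i , k , minimal , g≗ , D≡)
  with ECpx-instantiate i k e l (Minimal⇒ClosedAt rep minimal) cost
... | K′ , cost′ , K′≤ =
  instantiate i (3 ^ k) e ,
  Represents-resp (instantiate-Represents i (3 ^ k) rep (Minimal⇒ClosedAt rep minimal))
                  (λ σ → sym (g≗ σ)) ,
  K′ , cost′ , ≤-trans K′≤ (≤-trans (+-monoˡ-≤ (3 * k) K≤C) (≤-reflexive (sym D≡)))

Trunc⇒LowDefectPair : {f : Poly r} {C : ℕ} {g : Poly s} {D : ℕ} →
                      LowDefectPair f C → Trunc f C g D → LowDefectPair g D
Trunc⇒LowDefectPair (e , rep , K , cost , K≤C) (done g≗f D≡C) =
  e , Represents-resp rep (λ σ → sym (g≗f σ)) , K , cost , ≤-trans K≤C (≤-reflexive (sym D≡C))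
Trunc⇒LowDefectPair ldp (step tr dt) = DirectTrunc⇒LowDefectPair (Trunc⇒LowDefectPair ldp tr) dt

LowDefectPair-cong : {f : Poly r} {C : ℕ} → LowDefectPair f C →
                     ∀ {σ τ} → (∀ z → σ z ≡ τ z) → f σ ≡ f τ
LowDefectPair-cong (e , (_ , _ , e≗f) , _) {σ} {τ} σ≗τ =
  trans (sym (e≗f σ)) (trans (eval-cong e (λ z _ → σ≗τ z)) (e≗f τ))

-- Substitution patterns

data Pattern : ℕ → ℕ → Set where
  []  : Pattern 0 0
  ⋆∷_ : Pattern r s → Pattern (suc r) (suc s)
  _∷_ : ℕ → Pattern r s → Pattern (suc r) s

⌊_⌋ : Pattern r s → Vec (Maybe ℕ) r
⌊ [] ⌋    = []
⌊ ⋆∷ P ⌋  = nothing ∷ ⌊ P ⌋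
⌊ k ∷ P ⌋ = just k ∷ ⌊ P ⌋

toPattern : (p : Vec (Maybe ℕ) r) → Pattern r (stars p)
toPattern []            = []
toPattern (nothing ∷ p) = ⋆∷ toPattern p
toPattern (just k ∷ p)  = k ∷ toPattern p

⌊toPattern⌋ : (p : Vec (Maybe ℕ) r) → ⌊ toPattern p ⌋ ≡ p
⌊toPattern⌋ []            = refl
⌊toPattern⌋ (nothing ∷ p) = cong (nothing ∷_) (⌊toPattern⌋ p)
⌊toPattern⌋ (just k ∷ p)  = cong (just k ∷_) (⌊toPattern⌋ p)

stars-⌊⌋ : (P : Pattern r s) → stars ⌊ P ⌋ ≡ s
stars-⌊⌋ []      = refl
stars-⌊⌋ (⋆∷ P)  = cong suc (stars-⌊⌋ P)
stars-⌊⌋ (k ∷ P) = stars-⌊⌋ P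

JustAt : Pattern r s → Fin r → Set
JustAt P i = Is-just (lookup ⌊ P ⌋ i)

plug : Pattern r s → (ℕ → A) → (Fin s → A) → Fin r → A
plug (⋆∷ P)  h ys zero    = ys zero
plug (⋆∷ P)  h ys (suc i) = plug P h (λ j → ys (suc j)) i
plug (k ∷ P) h ys zero    = h k
plug (k ∷ P) h ys (suc i) = plug P h ys i

fill-toPattern : (p : Vec (Maybe ℕ) r) (h : ℕ → A) (ys : Fin (stars p) → A) (z : Fin r) →
                 fill p h ys z ≡ plug (toPattern p) h ys z
fill-toPattern (nothing ∷ p) h ys zero    = refl
fill-toPattern (nothing ∷ p) h ys (suc z) = fill-toPattern p h (λ j → ys (suc j)) z
fill-toPattern (just k ∷ p)  h ys zero    = refl
fill-toPattern (just k ∷ p)  h ys (suc z) = fill-toPattern p h ys z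

fill-⌊⌋ : (P : Pattern r s) .(e : stars ⌊ P ⌋ ≡ s) (h : ℕ → A) (ys : Fin s → A) (z : Fin r) →
          fill ⌊ P ⌋ h (λ j → ys (cast e j)) z ≡ plug P h ys z
fill-⌊⌋ (⋆∷ P)  e h ys zero    = refl
fill-⌊⌋ (⋆∷ P)  e h ys (suc z) = fill-⌊⌋ P (cong pred e) h (λ j → ys (suc j)) z
fill-⌊⌋ (k ∷ P) e h ys zero    = refl
fill-⌊⌋ (k ∷ P) e h ys (suc z) = fill-⌊⌋ P e h ys z

starAt : Pattern r s → Fin s → Fin r
starAt (⋆∷ P)  zero    = zero
starAt (⋆∷ P)  (suc j) = suc (starAt P j)
starAt (k ∷ P) j       = suc (starAt P j)

starIndex : (P : Pattern r s) (z : Fin r) → lookup ⌊ P ⌋ z ≡ nothing → Fin s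
starIndex (⋆∷ P)  zero    _  = zero
starIndex (⋆∷ P)  (suc z) eq = suc (starIndex P z eq)
starIndex (k ∷ P) (suc z) eq = starIndex P z eq

starAt-starIndex : (P : Pattern r s) (z : Fin r) (eq : lookup ⌊ P ⌋ z ≡ nothing) →
                   starAt P (starIndex P z eq) ≡ z
starAt-starIndex (⋆∷ P)  zero    _  = refl
starAt-starIndex (⋆∷ P)  (suc z) eq = cong suc (starAt-starIndex P z eq)
starAt-starIndex (k ∷ P) (suc z) eq = cong suc (starAt-starIndex P z eq)

plug-starAt : (P : Pattern r s) (h : ℕ → A) (ys : Fin s → A) (j : Fin s) →
              plug P h ys (starAt P j) ≡ ys j
plug-starAt (⋆∷ P)  h ys zero    = refl
plug-starAt (⋆∷ P)  h ys (suc j) = plug-starAt P h (λ j → ys (suc j)) j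
plug-starAt (k ∷ P) h ys j       = plug-starAt P h ys j

plug-just : (P : Pattern r s) (h : ℕ → A) (ys : Fin s → A) {z : Fin r} {k : ℕ} →
            lookup ⌊ P ⌋ z ≡ just k → plug P h ys z ≡ h k
plug-just (⋆∷ P)  h ys {suc z} eq   = plug-just P h (λ j → ys (suc j)) eq
plug-just (k ∷ P) h ys {zero}  refl = refl
plug-just (k ∷ P) h ys {suc z} eq   = plug-just P h ys eq

plug-star : (P : Pattern r s) (h : ℕ → A) (ys : Fin s → A) {z : Fin r} (eq : lookup ⌊ P ⌋ z ≡ nothing) →
            plug P h ys z ≡ ys (starIndex P z eq)
plug-star P h ys {z} eq =
  trans (cong (plug P h ys) (sym (starAt-starIndex P z eq))) (plug-starAt P h ys _)

starIndex-injective : (P : Pattern r s) {z w : Fin r}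
                      (ez : lookup ⌊ P ⌋ z ≡ nothing) (ew : lookup ⌊ P ⌋ w ≡ nothing) →
                      starIndex P z ez ≡ starIndex P w ew → z ≡ w
starIndex-injective P {z} {w} ez ew same =
  trans (sym (starAt-starIndex P z ez)) (trans (cong (starAt P) same) (starAt-starIndex P w ew))

plug-cong-off : (P : Pattern r s) (h : ℕ → A) {ys ys′ : Fin s → A} {x : Fin r}
                (ex : lookup ⌊ P ⌋ x ≡ nothing) →
                (∀ j → j ≢ starIndex P x ex → ys j ≡ ys′ j) →
                ∀ z → z ≢ x → plug P h ys z ≡ plug P h ys′ z
plug-cong-off P h {ys} {ys′} ex agree z z≢x with lookup ⌊ P ⌋ z in ez
... | just k  = trans (plug-just P h ys ez) (sym (plug-just P h ys′ ez))
... | nothing =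
  trans (plug-star P h ys ez)
        (trans (agree _ λ same → z≢x (starIndex-injective P ez ex same)) (sym (plug-star P h ys′ ez)))

remove : (P : Pattern (suc r) s) (i : Fin (suc r)) {k : ℕ} → lookup ⌊ P ⌋ i ≡ just k → Pattern r s
remove (k ∷ P) zero refl = P
remove {r = suc r} (⋆∷ P)  (suc i) eq = ⋆∷ remove P i eq
remove {r = suc r} (k′ ∷ P) (suc i) eq = k′ ∷ remove P i eq

lookup-remove : (P : Pattern (suc r) s) (i : Fin (suc r)) {k : ℕ} (eq : lookup ⌊ P ⌋ i ≡ just k)
                (x : Fin r) → lookup ⌊ remove P i eq ⌋ x ≡ lookup ⌊ P ⌋ (punchIn i x)
lookup-remove (k ∷ P) zero refl x = refl
lookup-remove {r = suc r} (⋆∷ P)  (suc i) eq zero    = refl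
lookup-remove {r = suc r} (⋆∷ P)  (suc i) eq (suc x) = lookup-remove P i eq x
lookup-remove {r = suc r} (k′ ∷ P) (suc i) eq zero    = refl
lookup-remove {r = suc r} (k′ ∷ P) (suc i) eq (suc x) = lookup-remove P i eq x

plug-remove : (P : Pattern (suc r) s) (i : Fin (suc r)) {k : ℕ} (eq : lookup ⌊ P ⌋ i ≡ just k)
              (h : ℕ → A) (ys : Fin s → A) (z : Fin (suc r)) →
              plug P h ys z ≡ insertAt (plug (remove P i eq) h ys) i (h k) z
plug-remove (k ∷ P) zero refl h ys zero    = refl
plug-remove (k ∷ P) zero refl h ys (suc z) = refl
plug-remove {r = suc r} (⋆∷ P)  (suc i) eq h ys zero    = refl
plug-remove {r = suc r} (⋆∷ P)  (suc i) eq h ys (suc z) = plug-remove P i eq h (λ j → ys (suc j)) z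
plug-remove {r = suc r} (k′ ∷ P) (suc i) eq h ys zero    = refl
plug-remove {r = suc r} (k′ ∷ P) (suc i) eq h ys (suc z) = plug-remove P i eq h ys z

sumJust-remove : (P : Pattern (suc r) s) (i : Fin (suc r)) {k : ℕ} (eq : lookup ⌊ P ⌋ i ≡ just k) →
                 sumJust ⌊ P ⌋ ≡ k + sumJust ⌊ remove P i eq ⌋
sumJust-remove (k ∷ P) zero refl = refl
sumJust-remove {r = suc r} (⋆∷ P)  (suc i) eq = sumJust-remove P i eq
sumJust-remove {r = suc r} (k′ ∷ P) (suc i) {k} eq =
  trans (cong (k′ +_) (sumJust-remove P i eq)) (x∙yz≈y∙xz k′ k _)

fixStar : Pattern r (suc s) → Fin (suc s) → ℕ → Pattern r s
fixStar (⋆∷ P)  zero    k = k ∷ P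
fixStar {s = suc s} (⋆∷ P) (suc j) k = ⋆∷ fixStar P j k
fixStar (k′ ∷ P) j      k = k′ ∷ fixStar P j k

plug-fixStar : (P : Pattern r (suc s)) (j : Fin (suc s)) (k : ℕ)
               (h : ℕ → A) (ys : Fin s → A) (z : Fin r) →
               plug (fixStar P j k) h ys z ≡ plug P h (insertAt ys j (h k)) z
plug-fixStar (⋆∷ P)  zero k h ys zero    = refl
plug-fixStar (⋆∷ P)  zero k h ys (suc z) = refl
plug-fixStar {s = suc s} (⋆∷ P) (suc j) k h ys zero    = refl
plug-fixStar {s = suc s} (⋆∷ P) (suc j) k h ys (suc z) = plug-fixStar P j k h (λ j → ys (suc j)) z
plug-fixStar (k′ ∷ P) j k h ys zero    = refl
plug-fixStar (k′ ∷ P) j k h ys (suc z) = plug-fixStar P j k h ys z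

sumJust-fixStar : (P : Pattern r (suc s)) (j : Fin (suc s)) (k : ℕ) →
                  sumJust ⌊ fixStar P j k ⌋ ≡ k + sumJust ⌊ P ⌋
sumJust-fixStar (⋆∷ P)  zero    k = refl
sumJust-fixStar {s = suc s} (⋆∷ P) (suc j) k = sumJust-fixStar P j k
sumJust-fixStar (k′ ∷ P) j k = trans (cong (k′ +_) (sumJust-fixStar P j k)) (x∙yz≈y∙xz k′ k _)

lookup-fixStar-starAt : (P : Pattern r (suc s)) (j : Fin (suc s)) (k : ℕ) →
                        lookup ⌊ fixStar P j k ⌋ (starAt P j) ≡ just k
lookup-fixStar-starAt (⋆∷ P)  zero    k = refl
lookup-fixStar-starAt {s = suc s} (⋆∷ P) (suc j) k = lookup-fixStar-starAt P j k
lookup-fixStar-starAt (k′ ∷ P) j k = lookup-fixStar-starAt P j k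

lookup-fixStar : (P : Pattern r (suc s)) (j : Fin (suc s)) (k : ℕ) {z : Fin r} → z ≢ starAt P j →
                 lookup ⌊ fixStar P j k ⌋ z ≡ lookup ⌊ P ⌋ z
lookup-fixStar (⋆∷ P)  zero k {zero}  z≢ = ⊥-elim (z≢ refl)
lookup-fixStar (⋆∷ P)  zero k {suc z} z≢ = refl
lookup-fixStar {s = suc s} (⋆∷ P) (suc j) k {zero}  z≢ = refl
lookup-fixStar {s = suc s} (⋆∷ P) (suc j) k {suc z} z≢ = lookup-fixStar P j k (z≢ ∘ cong suc)
lookup-fixStar (k′ ∷ P) j k {zero}  z≢ = refl
lookup-fixStar (k′ ∷ P) j k {suc z} z≢ = lookup-fixStar P j k (z≢ ∘ cong suc)

NoJust : Pattern r s → Set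
NoJust P = ∀ z → lookup ⌊ P ⌋ z ≡ nothing

NoJust⇒≡ : (P : Pattern r s) → NoJust P → s ≡ r
NoJust⇒≡ []      none = refl
NoJust⇒≡ (⋆∷ P)  none = cong suc (NoJust⇒≡ P (none ∘ suc))
NoJust⇒≡ (k ∷ P) none with none zero
... | ()

plug-NoJust : (P : Pattern r r) → NoJust P → (h : ℕ → A) (ys : Fin r → A) (z : Fin r) →
              plug P h ys z ≡ ys z
plug-NoJust (⋆∷ P)  none h ys zero    = refl
plug-NoJust (⋆∷ P)  none h ys (suc z) = plug-NoJust P (none ∘ suc) h (λ j → ys (suc j)) z
plug-NoJust (k ∷ P) none h ys z with none zero
... | ()

sumJust-NoJust : (P : Pattern r s) → NoJust P → sumJust ⌊ P ⌋ ≡ 0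
sumJust-NoJust []      none = refl
sumJust-NoJust (⋆∷ P)  none = sumJust-NoJust P (none ∘ suc)
sumJust-NoJust (k ∷ P) none with none zero
... | ()

allStars : ∀ r → Pattern r r
allStars zero    = []
allStars (suc r) = ⋆∷ allStars r

NoJust-allStars : ∀ r → NoJust (allStars r)
NoJust-allStars (suc r) zero    = refl
NoJust-allStars (suc r) (suc z) = NoJust-allStars r z

JustAt-fixStar : (P : Pattern r (suc s)) (j : Fin (suc s)) (k : ℕ) {z : Fin r} →
                 JustAt P z → JustAt (fixStar P j k) z
JustAt-fixStar (⋆∷ P)  zero    k {suc z} just-z = just-z
JustAt-fixStar {s = suc s} (⋆∷ P) (suc j) k {suc z} just-z = JustAt-fixStar P j k just-z
JustAt-fixStar (k′ ∷ P) j k {zero}  just-z = just-z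
JustAt-fixStar (k′ ∷ P) j k {suc z} just-z = JustAt-fixStar P j k just-z

-- Truncations

+-3*-distrib : ∀ C a b → C + 3 * (a + b) ≡ C + 3 * a + 3 * b
+-3*-distrib = solve-∀

Trunc-resp : {f : Poly r} {C : ℕ} {g g′ : Poly s} {D D′ : ℕ} →
             Trunc f C g D → g′ ≗ₚ g → D′ ≡ D → Trunc f C g′ D′
Trunc-resp (done g≗f D≡C) g′≗g D′≡D = done (λ σ → trans (g′≗g σ) (g≗f σ)) (trans D′≡D D≡C)
Trunc-resp (step tr (i , k , minimal , h≗ , E≡)) g′≗g D′≡D =
  step tr (i , k , minimal , (λ σ → trans (g′≗g σ) (h≗ σ)) , trans D′≡D E≡)

prepend : {f : Poly (suc r)} {f′ : Poly r} {C C′ : ℕ} {g : Poly s} {D : ℕ} →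
          DirectTrunc f C f′ C′ → Trunc f′ C′ g D → Trunc f C g D
prepend (i , k , minimal , f′≗ , C′≡) (done g≗f′ D≡C′) =
  step (done (λ _ → refl) refl) (i , k , minimal , (λ σ → trans (g≗f′ σ) (f′≗ σ)) , trans D≡C′ C′≡)
prepend direct (step tr direct′) = step (prepend direct tr) direct′

Is-just-nothing : Is-just {A = A} nothing → ⊥
Is-just-nothing ()

ClosedJustNode : Pattern r s → Expr r → Set
ClosedJustNode {r} P e = Σ (Fin r) λ i → Σ ℕ λ k → lookup ⌊ P ⌋ i ≡ just k ×
                         Σ (Expr r) λ e₀ → Σ ℕ λ c → lin e₀ i c ⊑ e × Closed e₀

-- An innermost node of a fixed variable has a closed body: its variables lie below the
-- node's variable, so are fixed by downward closure, yet the body contains no fixed variable.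
closedJustNode-or-stars : {f : Poly r} {e : Expr r} (P : Pattern r s) → Represents e f →
  DownClosed f (JustAt P) → (t : Expr r) → t ⊑ e →
  ClosedJustNode P e ⊎ (∀ z → z ∈ vars t → lookup ⌊ P ⌋ z ≡ nothing)
closedJustNode-or-stars P rep dc (con n) _ = inj₂ λ _ ()
closedJustNode-or-stars P rep dc (a ⊗ b) q
  with closedJustNode-or-stars P rep dc a (⊑-trans (inl here) q)
     | closedJustNode-or-stars P rep dc b (⊑-trans (inr here) q)
... | inj₁ node | _         = inj₁ node
... | inj₂ _    | inj₁ node = inj₁ node
... | inj₂ sa   | inj₂ sb   = inj₂ λ z m → [ sa z , sb z ]′ (∈-++⁻ (vars a) m)
closedJustNode-or-stars P rep dc (lin e′ z c) q
  with closedJustNode-or-stars P rep dc e′ (⊑-trans (inlin here) q)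
... | inj₁ node = inj₁ node
... | inj₂ stars-e′ with lookup ⌊ P ⌋ z in Pz
...   | just k  = inj₁ (z , k , Pz , e′ , c , q , closed)
  where
  closed : Closed e′
  closed y m = Is-just-nothing (subst Is-just (stars-e′ y m)
    (dc y z (subst Is-just (sym Pz) (just tt)) (NestE⇒Nest rep (e′ , c , q , there m))))
...   | nothing = inj₂ λ { w (here refl) → Pz ; w (there m) → stars-e′ w m }

truncate-NoJust : {f : Poly r} {C : ℕ} → LowDefectPair f C → (P : Pattern r s) → NoJust P →
                  Trunc f C (λ y → f (plug P (3 ^_) y)) (C + 3 * sumJust ⌊ P ⌋)
truncate-NoJust {C = C} ldp P none with NoJust⇒≡ P none
... | refl = done (λ y → LowDefectPair-cong ldp (plug-NoJust P none (3 ^_) y))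
                  (trans (cong (λ t → C + 3 * t) (sumJust-NoJust P none)) (+-identityʳ C))

truncate-pattern : {f : Poly r} {C : ℕ} → LowDefectPair f C →
                   (P : Pattern r s) → DownClosed f (JustAt P) →
                   Trunc f C (λ y → f (plug P (3 ^_) y)) (C + 3 * sumJust ⌊ P ⌋)
truncate-pattern ldp@(e , rep@(_ , all∈ , _) , _) P dc with closedJustNode-or-stars P rep dc e here
... | inj₂ stars = truncate-NoJust ldp P λ z → stars z (all∈ z)
truncate-pattern {r = zero} _ _ _ | inj₁ (() , _)
truncate-pattern {r = suc r} {f = f} {C} ldp@(e , rep , _) P dc
  | inj₁ (i , k , Pᵢ≡k , e₀ , c , node , closed) =
  Trunc-resp (prepend direct (truncate-pattern (DirectTrunc⇒LowDefectPair ldp direct) P′ dc′))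
             (λ y → LowDefectPair-cong ldp (plug-remove P i Pᵢ≡k (3 ^_) y))
             cost
  where
  P′ = remove P i Pᵢ≡k
  minimal = closedNode⇒Minimal rep node closed
  direct : DirectTrunc f C (λ σ → f (insertAt σ i (3 ^ k))) (C + 3 * k)
  direct = i , k , minimal , (λ _ → refl) , refl
  dc′ : DownClosed (λ σ → f (insertAt σ i (3 ^ k))) (JustAt P′)
  dc′ x y just-y nest =
    subst Is-just (sym (lookup-remove P i Pᵢ≡k x))
      (dc _ _ (subst Is-just (lookup-remove P i Pᵢ≡k y) just-y)
              (NestE⇒Nest rep (NestE-instantiate i (3 ^ k) e
                (nest _ (instantiate-Represents i (3 ^ k) rep (Minimal⇒ClosedAt rep minimal))))))
  cost : C + 3 * sumJust ⌊ P ⌋ ≡ C + 3 * k + 3 * sumJust ⌊ P′ ⌋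
  cost = trans (cong (λ t → C + 3 * t) (sumJust-remove P i Pᵢ≡k)) (+-3*-distrib C k _)

Indep-plug : (P : Pattern r s) (h : ℕ → ℕ) {f : Poly r} {g : Poly s} →
             (∀ y → g y ≡ f (plug P h y)) → {x : Fin r} {j : Fin s} (x⋆ : lookup ⌊ P ⌋ x ≡ nothing) →
             Indep f x (starAt P j) → Indep g (starIndex P x x⋆) j
Indep-plug P h {f} g≗ {j = j} x⋆ ind σ τ σj≡0 agree =
  trans (g≗ σ) (trans (ind _ _ (trans (plug-starAt P h σ j) σj≡0) (plug-cong-off P h x⋆ agree))
                      (sym (g≗ τ)))

DownClosed-fixStar : {f : Poly r} {g : Poly (suc s)} {e : Expr r} {h : ℕ → ℕ} →
  Represents e f → (P : Pattern r (suc s)) → DownClosed f (JustAt P) →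
  (∀ y → g y ≡ f (plug P h y)) → {j : Fin (suc s)} → Minimal g j → ∀ k →
  DownClosed f (JustAt (fixStar P j k))
DownClosed-fixStar {h = h} rep P dc g≗ {j} minimal k x y just-y nest with y ≟ᶠ starAt P j
... | no y≢ = JustAt-fixStar P j k (dc x y (subst Is-just (lookup-fixStar P j k y≢) just-y) nest)
... | yes refl with x ≟ᶠ starAt P j
...   | yes refl = subst Is-just (sym (lookup-fixStar-starAt P j k)) (just tt)
...   | no x≢ with lookup ⌊ P ⌋ x in x⋆
...     | just _  = JustAt-fixStar P j k (subst Is-just (sym x⋆) (just tt))
...     | nothing =
  ⊥-elim (jx≢j (minimal _ (Indep⇒Nest jx≢j (Indep-plug P h g≗ x⋆ (Nest⇒Indep rep x≢ nest)))))
  where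
  jx≢j : starIndex P x x⋆ ≢ j
  jx≢j jx≡j = x≢ (trans (sym (starAt-starIndex P x x⋆)) (cong (starAt P) jx≡j))

pattern-of-Trunc : {f : Poly r} {C : ℕ} {g : Poly s} {D : ℕ} → LowDefectPair f C → Trunc f C g D →
  Σ (Pattern r s) λ P → DownClosed f (JustAt P)
    × (∀ y → g y ≡ f (plug P (3 ^_) y)) × D ≡ C + 3 * sumJust ⌊ P ⌋
pattern-of-Trunc {r = r} {C = C} ldp (done g≗f D≡C) =
  allStars r ,
  (λ x y just-y _ → ⊥-elim (Is-just-nothing (subst Is-just (none y) just-y))) ,
  (λ y → trans (g≗f y) (LowDefectPair-cong ldp λ z → sym (plug-NoJust (allStars r) none (3 ^_) y z))) ,
  trans D≡C (sym (trans (cong (λ t → C + 3 * t) (sumJust-NoJust (allStars r) none)) (+-identityʳ C)))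
  where none = NoJust-allStars r
pattern-of-Trunc {C = C} ldp@(_ , rep , _) (step tr (j , k , minimal , h≗ , E≡))
  with pattern-of-Trunc ldp tr
... | P , dc , g≗ , D≡ =
  fixStar P j k ,
  DownClosed-fixStar rep P dc g≗ minimal k ,
  (λ y → trans (h≗ y) (trans (g≗ _)
                      (LowDefectPair-cong ldp λ z → sym (plug-fixStar P j k (3 ^_) y z)))) ,
  trans E≡ (trans (cong (_+ 3 * k) D≡) cost)
  where
  cost : C + 3 * sumJust ⌊ P ⌋ + 3 * k ≡ C + 3 * sumJust ⌊ fixStar P j k ⌋
  cost = trans (sym (+-3*-distrib C (sumJust ⌊ P ⌋) k))
               (cong (λ t → C + 3 * t) (trans (+-comm (sumJust ⌊ P ⌋) k) (sym (sumJust-fixStar P j k))))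

sumF-ι : (p : Vec (Maybe ℕ) r) (ℓ : Fin (stars p) → ℕ) → sumF (ι p ℓ) ≡ sumJust p + sumF ℓ
sumF-ι []            ℓ = refl
sumF-ι (nothing ∷ p) ℓ =
  trans (cong (ℓ zero +_) (sumF-ι p (λ j → ℓ (suc j)))) (x∙yz≈y∙xz (ℓ zero) (sumJust p) _)
sumF-ι (just k ∷ p)  ℓ = trans (cong (k +_) (sumF-ι p ℓ)) (sym (+-assoc k (sumJust p) (sumF ℓ)))

fill-map : {B : Set} (p : Vec (Maybe ℕ) r) (h : ℕ → A) (g : A → B) (ys : Fin (stars p) → A) (z : Fin r) →
           fill p (λ k → g (h k)) (λ j → g (ys j)) z ≡ g (fill p h ys z)
fill-map (nothing ∷ p) h g ys zero    = refl
fill-map (nothing ∷ p) h g ys (suc z) = fill-map p h g (λ j → ys (suc j)) z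
fill-map (just k ∷ p)  h g ys zero    = refl
fill-map (just k ∷ p)  h g ys (suc z) = fill-map p h g ys z

≈δ-reflexive : {x y : ℕ × ℕ} → x ≡ y → x ≈δ y
≈δ-reflexive refl = refl

δ-substitution : {f : Poly r} {C : ℕ} → LowDefectPair f C →
                 (p : Vec (Maybe ℕ) r) (ℓ : Fin (stars p) → ℕ) →
                 δ (subPoly p f) (subConst p C) ℓ ≈δ δ f C (ι p ℓ)
δ-substitution {C = C} ldp p ℓ = ≈δ-reflexive (cong₂ _,_ exponent value)
  where
  exponent : C + 3 * sumJust p + 3 * sumF ℓ ≡ C + 3 * sumF (ι p ℓ)
  exponent = trans (sym (+-3*-distrib C (sumJust p) (sumF ℓ)))
                   (cong (λ t → C + 3 * t) (sym (sumF-ι p ℓ)))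
  value = LowDefectPair-cong ldp (fill-map p (λ k → k) (3 ^_) ℓ)

Trunc-substitution : {f : Poly r} {C : ℕ} → LowDefectPair f C → (p : Vec (Maybe ℕ) r) →
                     DownClosed f (λ i → Is-just (lookup p i)) → Trunc f C (subPoly p f) (subConst p C)
Trunc-substitution {f = f} {C} ldp p dc =
  Trunc-resp (truncate-pattern ldp (toPattern p)
               (subst (λ q → DownClosed f (λ i → Is-just (lookup q i))) (sym (⌊toPattern⌋ p)) dc))
             (λ y → LowDefectPair-cong ldp (fill-toPattern p (3 ^_) y))
             (cong (λ q → C + 3 * sumJust q) (sym (⌊toPattern⌋ p)))

Trunc⇒substitution : {f : Poly r} {C : ℕ} {g : Poly s} {D : ℕ} → LowDefectPair f C → Trunc f C g D →
  Σ (Vec (Maybe ℕ) r) λ p → DownClosed f (λ i → Is-just (lookup p i))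
    × Σ (stars p ≡ s) λ e → (∀ (y : Fin s → ℕ) → g y ≡ subPoly p f (λ j → y (cast e j)))
                            × D ≡ subConst p C
Trunc⇒substitution ldp tr with pattern-of-Trunc ldp tr
... | P , dc , g≗ , D≡ =
  ⌊ P ⌋ , dc , stars-⌊⌋ P ,
  (λ y → trans (g≗ y) (LowDefectPair-cong ldp λ z → sym (fill-⌊⌋ P (stars-⌊⌋ P) (3 ^_) y z))) ,
  D≡

proposition4p5 :
    ∀ {r} (f : Poly r) (C : ℕ) → LowDefectPair f C →
      (((p : Vec (Maybe ℕ) r) → DownClosed f (λ i → Is-just (lookup p i)) →
          Trunc f C (subPoly p f) (subConst p C)
          × LowDefectPair (subPoly p f) (subConst p C)
          × ((ℓ : Fin (stars p) → ℕ) →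
               δ (subPoly p f) (subConst p C) ℓ ≈δ δ f C (ι p ℓ)))
      × (∀ {s} (g : Poly s) (D : ℕ) → Trunc f C g D →
          Σ (Vec (Maybe ℕ) r) λ p →
            DownClosed f (λ i → Is-just (lookup p i))
            × Σ (stars p ≡ s) λ e →
                (∀ (y : Fin s → ℕ) → g y ≡ subPoly p f (λ j → y (cast e j)))
                × D ≡ subConst p C))
proposition4p5 f C ldp =
  (λ p dc → let trunc = Trunc-substitution ldp p dc in
            trunc , Trunc⇒LowDefectPair ldp trunc , δ-substitution ldp p) ,
  λ g D → Trunc⇒substitution ldp
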